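{- Let $I$ be an index set, $(]a_i,b_i[)_{i\in I}$ a family of nonempty, pairwise disjoint open subintervals of $[0,1]$ and $(N_i)_{i\in I}$ a family of invertible fuzzy negations. Let $N_I$ be the ordinal sum of the summands $(a_i,b_i,N_i)_{i\in I}$ and let $N_I^{ -1}$ denote the ordinal sum of the summands $(1-b_i,1-a_i,N_i^{ -1})_{i\in I}$. Then $N_I^{ -1}$ is the inverse of $N_I$, i.e. $N_I(N_I^{ -1}(x))=N_I^{ -1}(N_I(x))=x$ for all $x\in[0,1]$.
   Context: A fuzzy negation is a function $N:[0,1]\to[0,1]$ with $N(0)=1$, $N(1)=0$ and $N(x)\ge N(y)$ whenever $x\le y$; it is invertible if it is a bijection of $[0,1]$, in which case its inverse $N^{ -1}$ is again a fuzzy negation. Given a family $(]c_i,d_i[)_{i\in I}$ of nonempty pairwise disjoint open subintervals of $[0,1]$ and a family $(M_i)_{i\in I}$ of fuzzy negations, the ordinal sum of the summands $(c_i,d_i,M_i)_{i\in I}$ is the function $M_I:[0,1]\to[0,1]$ defined by $M_I(x)=(1-d_i)+(d_i-c_i)\,M_i\!\left(\frac{x-c_i}{d_i-c_i}\right)$ if $x\in[c_i,d_i]$ for some $i\in I$, and $M_I(x)=1-x$ otherwise. (Note that $(]1-b_i,1-a_i[)_{i\in I}$ is again a family of nonempty pairwise disjoint open subintervals of $[0,1]$.) -}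

module Defs where

open import Level using (0ℓ)
open import Data.Product using (Σ; ∃; _×_; _,_)
open import Data.Sum using (_⊎_)
open import Relation.Nullary using (¬_)
open import Relation.Binary.PropositionalEquality using (_≡_; _≢_)
open import Algebra.Structures using (IsCommutativeRing)

-- The real numbers, axiomatised as a complete ordered field
-- (every complete ordered field is isomorphic to ℝ).
record RealField : Set₁ where
  infixl 6 _+_ _-_
  infixl 7 _*_
  infix  8 -_ _⁻¹
  infix  4 _<_ _≤_
  field
    ℝ   : Set
    _+_ _*_ : ℝ → ℝ → ℝ
    -_  : ℝ → ℝ
    0ℝ 1ℝ : ℝ
    _⁻¹ : ℝ → ℝ
    _<_ : ℝ → ℝ → Set
    isCommutativeRing : IsCommutativeRing _≡_ _+_ _*_ -_ 0ℝ 1ℝ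
    0≢1       : 0ℝ ≢ 1ℝ
    ⁻¹-inverse : ∀ x → x ≢ 0ℝ → x * (x ⁻¹) ≡ 1ℝ
    <-irrefl  : ∀ x → ¬ (x < x)
    <-trans   : ∀ {x y z} → x < y → y < z → x < z
    <-trichotomy : ∀ x y → x < y ⊎ (x ≡ y ⊎ y < x)
    +-mono-<  : ∀ {x y} z → x < y → x + z < y + z
    *-pos     : ∀ {x y} → 0ℝ < x → 0ℝ < y → 0ℝ < x * y

  _-_ : ℝ → ℝ → ℝ
  x - y = x + (- y)

  _≤_ : ℝ → ℝ → Set
  x ≤ y = x < y ⊎ x ≡ y

  field
    complete : (P : ℝ → Set) → ∃ P → (∃ λ u → ∀ x → P x → x ≤ u) →
               ∃ λ s → (∀ x → P x → x ≤ s) × (∀ u → (∀ x → P x → x ≤ u) → s ≤ u)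

  field
    -- the paper works in classical mathematics; we make the ambient
    -- excluded middle available (needed e.g. to decide whether x lies
    -- in some summand interval of an ordinal sum over an arbitrary I)
    excluded-middle : (P : Set) → P ⊎ ¬ P

  InUnit : ℝ → Set
  InUnit x = 0ℝ ≤ x × x ≤ 1ℝ

module _ (R : RealField) where
  open RealField R

  -- A fuzzy negation N : [0,1] → [0,1], represented by a function on ℝ
  -- whose behaviour outside [0,1] is irrelevant.
  record IsFuzzyNegation (N : ℝ → ℝ) : Set where
    field
      maps-into : ∀ x → InUnit x → InUnit (N x)
      N0≡1      : N 0ℝ ≡ 1ℝ
      N1≡0      : N 1ℝ ≡ 0ℝ
      antitone  : ∀ x y → InUnit x → InUnit y → x ≤ y → N y ≤ N x

  IsInverseOnUnit : (F G : ℝ → ℝ) → Set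
  IsInverseOnUnit F G =
    (∀ x → InUnit x → InUnit (F x)) × (∀ x → InUnit x → InUnit (G x)) ×
    (∀ x → InUnit x → F (G x) ≡ x) × (∀ x → InUnit x → G (F x) ≡ x)

  -- N is an invertible fuzzy negation with inverse Ninv
  -- (the inverse of a bijection of [0,1] is unique).
  record IsInvertibleFuzzyNegation (N Ninv : ℝ → ℝ) : Set where
    field
      isFuzzyNegation : IsFuzzyNegation N
      isInverse       : IsInverseOnUnit N Ninv

  record IsIntervalFamily (I : Set) (c d : I → ℝ) : Set where
    field
      lower    : ∀ i → 0ℝ ≤ c i
      nonempty : ∀ i → c i < d i
      upper    : ∀ i → d i ≤ 1ℝ
      disjoint : ∀ i j → i ≢ j → ∀ x →
                 ¬ ((c i < x × x < d i) × (c j < x × x < d j))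

  record IsOrdinalSum (I : Set) (c d : I → ℝ) (Ms : I → ℝ → ℝ) (M : ℝ → ℝ) : Set where
    field
      on-summand : ∀ i x → c i ≤ x → x ≤ d i →
        M x ≡ (1ℝ - d i) + (d i - c i) * Ms i ((x - c i) * (d i - c i) ⁻¹)
      elsewhere  : ∀ x → InUnit x → (∀ i → ¬ (c i ≤ x × x ≤ d i)) →
        M x ≡ 1ℝ - x

-- On a summand interval [c, d], the ordinal sum rescales [c, d] affinely onto
-- [0, 1], applies the summand negation, and maps the result increasingly onto
-- the mirrored interval [1 - d, 1 - c]; off the summands it is x ↦ 1 - x.
-- The summands (1 - d, 1 - c, M⁻¹) of the second ordinal sum are exactly these
-- mirrored intervals, so on each of them it undoes the three steps in reverse
-- order, while points outside every summand are sent by x ↦ 1 - x to points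
-- outside every mirrored summand and back. This gives one composite; the
-- other is the same argument with the roles of the two sums exchanged, since
-- mirroring twice returns the original intervals.
module Submission where

open import Defs
open import Level using (0ℓ)
open import Data.Product using (_×_; _,_; ∃; proj₁; proj₂)
open import Data.Sum using (inj₁; inj₂)
open import Data.Empty using (⊥-elim)
open import Relation.Nullary using (¬_)
open import Function using (_∘_)
open import Relation.Binary.PropositionalEquality
  using (_≡_; _≢_; refl; sym; trans; cong; cong₂; subst; subst₂; module ≡-Reasoning)
open import Algebra.Bundles using (CommutativeRing)
open import Algebra.Structures using (IsCommutativeRing)

module _ (R : RealField) where
  open RealField R
  open IsCommutativeRing isCommutativeRing
    using (+-assoc; +-comm; +-identityˡ; +-identityʳ; *-assoc; *-comm; *-identityˡ; *-identityʳ;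
           distribʳ; zeroˡ; zeroʳ; -‿inverseʳ)
  open ≡-Reasoning

  commutativeRing : CommutativeRing 0ℓ 0ℓ
  commutativeRing = record { isCommutativeRing = isCommutativeRing }

  open import Algebra.Properties.Ring (CommutativeRing.ring commutativeRing)
    using (xyx⁻¹≈y; ⁻¹-anti-homo‿-; //-rightDividesˡ; \\-leftDividesʳ; -0#≈0#; -‿distribˡ-*)

  [x-y]+[y-z]≡x-z : ∀ x y z → (x - y) + (y - z) ≡ x - z
  [x-y]+[y-z]≡x-z x y z = begin
    (x - y) + (y - z)    ≡⟨ +-assoc x (- y) (y - z) ⟩
    x + (- y + (y - z))  ≡⟨ cong (x +_) (\\-leftDividesʳ y (- z)) ⟩
    x - z                ∎

  [w-x]-[w-y]≡y-x : ∀ w x y → (w - x) - (w - y) ≡ y - x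
  [w-x]-[w-y]≡y-x w x y = begin
    (w - x) - (w - y)  ≡⟨ cong ((w - x) +_) (⁻¹-anti-homo‿- w y) ⟩
    (w - x) + (y - w)  ≡⟨ +-comm (w - x) (y - w) ⟩
    (y - w) + (w - x)  ≡⟨ [x-y]+[y-z]≡x-z y w x ⟩
    y - x              ∎

  w-[w-x]≡x : ∀ w x → w - (w - x) ≡ x
  w-[w-x]≡x w x = begin
    w - (w - x)    ≡⟨ cong (w +_) (⁻¹-anti-homo‿- w x) ⟩
    w + (x - w)    ≡⟨ sym (+-assoc w x (- w)) ⟩
    w + x - w      ≡⟨ xyx⁻¹≈y w x ⟩
    x              ∎

  x+[y-x]≡y : ∀ x y → x + (y - x) ≡ y
  x+[y-x]≡y x y = trans (+-comm x (y - x)) (//-rightDividesˡ x y)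

  x*y*y⁻¹≡x : ∀ x {y} → y ≢ 0ℝ → x * y * y ⁻¹ ≡ x
  x*y*y⁻¹≡x x {y} y≢0 = begin
    x * y * y ⁻¹    ≡⟨ *-assoc x y (y ⁻¹) ⟩
    x * (y * y ⁻¹)  ≡⟨ cong (x *_) (⁻¹-inverse y y≢0) ⟩
    x * 1ℝ          ≡⟨ *-identityʳ x ⟩
    x               ∎

  y*[x*y⁻¹]≡x : ∀ x {y} → y ≢ 0ℝ → y * (x * y ⁻¹) ≡ x
  y*[x*y⁻¹]≡x x {y} y≢0 = begin
    y * (x * y ⁻¹)  ≡⟨ sym (*-assoc y x (y ⁻¹)) ⟩
    y * x * y ⁻¹    ≡⟨ cong (_* y ⁻¹) (*-comm y x) ⟩
    x * y * y ⁻¹    ≡⟨ x*y*y⁻¹≡x x y≢0 ⟩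
    x               ∎

  [x-y]*z≡x*z-y*z : ∀ x y z → (x - y) * z ≡ x * z - y * z
  [x-y]*z≡x*z-y*z x y z = trans (distribʳ z x (- y)) (cong (x * z +_) (sym (-‿distribˡ-* y z)))

  <⇒0<- : ∀ {x y} → x < y → 0ℝ < y - x
  <⇒0<- {x} x<y = subst (_< _) (-‿inverseʳ x) (+-mono-< (- x) x<y)

  0<-⇒< : ∀ {x y} → 0ℝ < y - x → x < y
  0<-⇒< {x} {y} 0<y-x = subst₂ _<_ (+-identityˡ x) (//-rightDividesˡ x y) (+-mono-< x 0<y-x)

  >0⇒≢0 : ∀ {x} → 0ℝ < x → x ≢ 0ℝ
  >0⇒≢0 0<x x≡0 = <-irrefl 0ℝ (subst (0ℝ <_) x≡0 0<x)

  +-monoˡ-≤ : ∀ z {x y} → x ≤ y → x + z ≤ y + z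
  +-monoˡ-≤ z (inj₁ x<y)  = inj₁ (+-mono-< z x<y)
  +-monoˡ-≤ z (inj₂ refl) = inj₂ refl

  +-monoʳ-≤ : ∀ z {x y} → x ≤ y → z + x ≤ z + y
  +-monoʳ-≤ z {x} {y} x≤y = subst₂ _≤_ (+-comm x z) (+-comm y z) (+-monoˡ-≤ z x≤y)

  *-monoˡ-< : ∀ {z x y} → 0ℝ < z → x < y → x * z < y * z
  *-monoˡ-< {z} {x} {y} 0<z x<y =
    0<-⇒< (subst (0ℝ <_) ([x-y]*z≡x*z-y*z y x z) (*-pos (<⇒0<- x<y) 0<z))

  *-monoˡ-≤ : ∀ {z x y} → 0ℝ < z → x ≤ y → x * z ≤ y * z
  *-monoˡ-≤ 0<z (inj₁ x<y)  = inj₁ (*-monoˡ-< 0<z x<y)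
  *-monoˡ-≤ 0<z (inj₂ refl) = inj₂ refl

  *-monoʳ-≤ : ∀ {z x y} → 0ℝ < z → x ≤ y → z * x ≤ z * y
  *-monoʳ-≤ {z} {x} {y} 0<z x≤y = subst₂ _≤_ (*-comm x z) (*-comm y z) (*-monoˡ-≤ 0<z x≤y)

  sub-antitone-< : ∀ w {x y} → x < y → w - y < w - x
  sub-antitone-< w {x} {y} x<y = 0<-⇒< (subst (0ℝ <_) (sym ([w-x]-[w-y]≡y-x w x y)) (<⇒0<- x<y))

  sub-antitone-≤ : ∀ w {x y} → x ≤ y → w - y ≤ w - x
  sub-antitone-≤ w (inj₁ x<y)  = inj₁ (sub-antitone-< w x<y)
  sub-antitone-≤ w (inj₂ refl) = inj₂ refl

  sub-reflect-≤ : ∀ w {x y} → w - y ≤ w - x → x ≤ y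
  sub-reflect-≤ w {x} {y} h = subst₂ _≤_ (w-[w-x]≡x w x) (w-[w-x]≡x w y) (sub-antitone-≤ w h)

  0<1 : 0ℝ < 1ℝ
  0<1 with <-trichotomy 0ℝ 1ℝ
  ... | inj₁ 0<1        = 0<1
  ... | inj₂ (inj₁ 0≡1) = ⊥-elim (0≢1 0≡1)
  ... | inj₂ (inj₂ 1<0) = ⊥-elim (<-irrefl 0ℝ (<-trans 0<-1 -1<0))
    where
    0<-1 : 0ℝ < - 1ℝ
    0<-1 = subst (0ℝ <_) (+-identityˡ (- 1ℝ)) (<⇒0<- 1<0)
    -1<0 : - 1ℝ < 0ℝ
    -1<0 = subst₂ _<_ (*-identityˡ (- 1ℝ)) (zeroˡ (- 1ℝ)) (*-monoˡ-< 0<-1 1<0)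

  ⁻¹-pos : ∀ {x} → 0ℝ < x → 0ℝ < x ⁻¹
  ⁻¹-pos {x} 0<x with <-trichotomy 0ℝ (x ⁻¹)
  ... | inj₁ 0<x⁻¹        = 0<x⁻¹
  ... | inj₂ (inj₁ 0≡x⁻¹) =
    ⊥-elim (0≢1 (begin
      0ℝ        ≡⟨ sym (zeroʳ x) ⟩
      x * 0ℝ    ≡⟨ cong (x *_) 0≡x⁻¹ ⟩
      x * x ⁻¹  ≡⟨ ⁻¹-inverse x (>0⇒≢0 0<x) ⟩
      1ℝ        ∎))
  ... | inj₂ (inj₂ x⁻¹<0) = ⊥-elim (<-irrefl 0ℝ (<-trans 0<1 1<0))
    where
    1<0 : 1ℝ < 0ℝ
    1<0 = subst₂ _<_ (trans (*-comm (x ⁻¹) x) (⁻¹-inverse x (>0⇒≢0 0<x))) (zeroˡ x)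
                     (*-monoˡ-< 0<x x⁻¹<0)

  complement-InUnit : ∀ {x} → InUnit x → InUnit (1ℝ - x)
  complement-InUnit {x} (0≤x , x≤1) =
    subst (_≤ 1ℝ - x) (-‿inverseʳ 1ℝ) (sub-antitone-≤ 1ℝ x≤1) ,
    subst (1ℝ - x ≤_) (trans (cong (1ℝ +_) -0#≈0#) (+-identityʳ 1ℝ)) (sub-antitone-≤ 1ℝ 0≤x)

  -- These are
  -- the two affine maps in the defining formula of an ordinal sum.
  rescale : ℝ → ℝ → ℝ → ℝ
  rescale c d x = (x - c) * (d - c) ⁻¹

  embedDual : ℝ → ℝ → ℝ → ℝ
  embedDual c d s = (1ℝ - d) + (d - c) * s

  rescale-InUnit : ∀ {c d x} → c < d → c ≤ x → x ≤ d → InUnit (rescale c d x)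
  rescale-InUnit {c} {d} {x} c<d c≤x x≤d =
    subst (_≤ rescale c d x) rescale-c≡0 (rescale-mono c≤x) ,
    subst (rescale c d x ≤_) rescale-d≡1 (rescale-mono x≤d)
    where
    rescale-mono : ∀ {y z} → y ≤ z → rescale c d y ≤ rescale c d z
    rescale-mono y≤z = *-monoˡ-≤ (⁻¹-pos (<⇒0<- c<d)) (+-monoˡ-≤ (- c) y≤z)
    rescale-c≡0 : rescale c d c ≡ 0ℝ
    rescale-c≡0 = trans (cong (_* (d - c) ⁻¹) (-‿inverseʳ c)) (zeroˡ ((d - c) ⁻¹))
    rescale-d≡1 : rescale c d d ≡ 1ℝ
    rescale-d≡1 = ⁻¹-inverse (d - c) (>0⇒≢0 (<⇒0<- c<d))

  embedDual-bounds : ∀ {c d s} → c < d → InUnit s →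
                     1ℝ - d ≤ embedDual c d s × embedDual c d s ≤ 1ℝ - c
  embedDual-bounds {c} {d} {s} c<d (0≤s , s≤1) =
    subst (_≤ embedDual c d s) embedDual-0 (embedDual-mono 0≤s) ,
    subst (embedDual c d s ≤_) embedDual-1 (embedDual-mono s≤1)
    where
    embedDual-mono : ∀ {t u} → t ≤ u → embedDual c d t ≤ embedDual c d u
    embedDual-mono t≤u = +-monoʳ-≤ (1ℝ - d) (*-monoʳ-≤ (<⇒0<- c<d) t≤u)
    embedDual-0 : embedDual c d 0ℝ ≡ 1ℝ - d
    embedDual-0 = trans (cong ((1ℝ - d) +_) (zeroʳ (d - c))) (+-identityʳ (1ℝ - d))
    embedDual-1 : embedDual c d 1ℝ ≡ 1ℝ - c
    embedDual-1 = trans (cong ((1ℝ - d) +_) (*-identityʳ (d - c))) ([x-y]+[y-z]≡x-z 1ℝ d c)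

  rescale-embedDual : ∀ {c d} → d - c ≢ 0ℝ → ∀ s →
                      rescale (1ℝ - d) (1ℝ - c) (embedDual c d s) ≡ s
  rescale-embedDual {c} {d} d-c≢0 s = begin
    ((1ℝ - d) + (d - c) * s - (1ℝ - d)) * ((1ℝ - c) - (1ℝ - d)) ⁻¹
      ≡⟨ cong₂ (λ u v → u * v ⁻¹) (xyx⁻¹≈y (1ℝ - d) ((d - c) * s))
                                   ([w-x]-[w-y]≡y-x 1ℝ c d) ⟩
    (d - c) * s * (d - c) ⁻¹
      ≡⟨ cong (_* (d - c) ⁻¹) (*-comm (d - c) s) ⟩
    s * (d - c) * (d - c) ⁻¹
      ≡⟨ x*y*y⁻¹≡x s d-c≢0 ⟩
    s ∎

  embedDual-rescale : ∀ {c d} → d - c ≢ 0ℝ → ∀ x →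
                      embedDual (1ℝ - d) (1ℝ - c) (rescale c d x) ≡ x
  embedDual-rescale {c} {d} d-c≢0 x = begin
    (1ℝ - (1ℝ - c)) + ((1ℝ - c) - (1ℝ - d)) * ((x - c) * (d - c) ⁻¹)
      ≡⟨ cong₂ (λ u v → u + v * ((x - c) * (d - c) ⁻¹)) (w-[w-x]≡x 1ℝ c)
                                                         ([w-x]-[w-y]≡y-x 1ℝ c d) ⟩
    c + (d - c) * ((x - c) * (d - c) ⁻¹)
      ≡⟨ cong (c +_) (y*[x*y⁻¹]≡x (x - c) d-c≢0) ⟩
    c + (x - c)
      ≡⟨ x+[y-x]≡y c x ⟩
    x ∎

  module _ {I : Set} {c d : I → ℝ} {Ms Ms′ : I → ℝ → ℝ} {M M′ : ℝ → ℝ}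
           (c<d : ∀ i → c i < d i)
           (Ms-InUnit : ∀ i t → InUnit t → InUnit (Ms i t))
           (Ms′∘Ms≡id : ∀ i t → InUnit t → Ms′ i (Ms i t) ≡ t)
           (sum : IsOrdinalSum R I c d Ms M)
           (sum′ : IsOrdinalSum R I (λ i → 1ℝ - d i) (λ i → 1ℝ - c i) Ms′ M′)
           where
    open IsOrdinalSum

    ordinalSum-leftInverse-onSummand : ∀ i x → c i ≤ x → x ≤ d i → M′ (M x) ≡ x
    ordinalSum-leftInverse-onSummand i x c≤x x≤d = begin
      M′ (M x)                         ≡⟨ cong M′ (on-summand sum i x c≤x x≤d) ⟩
      M′ y                             ≡⟨ on-summand sum′ i y y≥1-d y≤1-c ⟩
      embedDual′ (Ms′ i (rescale′ y))  ≡⟨ cong (embedDual′ ∘ Ms′ i) (rescale-embedDual d-c≢0 s) ⟩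
      embedDual′ (Ms′ i s)             ≡⟨ cong embedDual′ (Ms′∘Ms≡id i t t∈I) ⟩
      embedDual′ t                     ≡⟨ embedDual-rescale d-c≢0 x ⟩
      x                                ∎
      where
      rescale′ embedDual′ : ℝ → ℝ
      rescale′   = rescale (1ℝ - d i) (1ℝ - c i)
      embedDual′ = embedDual (1ℝ - d i) (1ℝ - c i)
      t s y : ℝ
      t = rescale (c i) (d i) x
      s = Ms i t
      y = embedDual (c i) (d i) s
      d-c≢0 : d i - c i ≢ 0ℝ
      d-c≢0 = >0⇒≢0 (<⇒0<- (c<d i))
      t∈I : InUnit t
      t∈I = rescale-InUnit (c<d i) c≤x x≤d
      y≥1-d : 1ℝ - d i ≤ y
      y≥1-d = proj₁ (embedDual-bounds (c<d i) (Ms-InUnit i t t∈I))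
      y≤1-c : y ≤ 1ℝ - c i
      y≤1-c = proj₂ (embedDual-bounds (c<d i) (Ms-InUnit i t t∈I))

    ordinalSum-leftInverse-elsewhere : ∀ x → InUnit x → (∀ i → ¬ (c i ≤ x × x ≤ d i)) →
                                       M′ (M x) ≡ x
    ordinalSum-leftInverse-elsewhere x x∈I x∉summands = begin
      M′ (M x)        ≡⟨ cong M′ (elsewhere sum x x∈I x∉summands) ⟩
      M′ (1ℝ - x)     ≡⟨ elsewhere sum′ (1ℝ - x) (complement-InUnit x∈I) 1-x∉summands ⟩
      1ℝ - (1ℝ - x)   ≡⟨ w-[w-x]≡x 1ℝ x ⟩
      x               ∎
      where
      1-x∉summands : ∀ i → ¬ (1ℝ - d i ≤ 1ℝ - x × 1ℝ - x ≤ 1ℝ - c i)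
      1-x∉summands i (lo , hi) = x∉summands i (sub-reflect-≤ 1ℝ hi , sub-reflect-≤ 1ℝ lo)

    ordinalSum-leftInverse : ∀ x → InUnit x → M′ (M x) ≡ x
    ordinalSum-leftInverse x x∈I with excluded-middle (∃ λ i → c i ≤ x × x ≤ d i)
    ... | inj₁ (i , c≤x , x≤d) = ordinalSum-leftInverse-onSummand i x c≤x x≤d
    ... | inj₂ x∉summands      =
      ordinalSum-leftInverse-elsewhere x x∈I (λ i x∈summand → x∉summands (i , x∈summand))

  ordinalSum-cong : ∀ {I : Set} {c c′ d d′ : I → ℝ} {Ms : I → ℝ → ℝ} {M : ℝ → ℝ} →
                    (∀ i → c i ≡ c′ i) → (∀ i → d i ≡ d′ i) →
                    IsOrdinalSum R I c d Ms M → IsOrdinalSum R I c′ d′ Ms M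
  ordinalSum-cong {c = c} {c′} {d} {d′} {Ms} {M} c≡c′ d≡d′ sum = record
    { on-summand = λ i x → on-summand′ i x (c≡c′ i) (d≡d′ i)
    ; elsewhere  = λ x x∈I x∉summands′ → elsewhere x x∈I λ i →
        subst₂ (λ γ δ → ¬ (γ ≤ x × x ≤ δ)) (sym (c≡c′ i)) (sym (d≡d′ i)) (x∉summands′ i)
    }
    where
    open IsOrdinalSum sum
    on-summand′ : ∀ i x {γ δ} → c i ≡ γ → d i ≡ δ → γ ≤ x → x ≤ δ →
                  M x ≡ (1ℝ - δ) + (δ - γ) * Ms i ((x - γ) * (δ - γ) ⁻¹)
    on-summand′ i x refl refl = on-summand i x

mainTheorem10 : (R : RealField) → let open RealField R in
    (I : Set) (a b : I → ℝ) (Ns Nsinv : I → ℝ → ℝ) (NI NIinv : ℝ → ℝ) →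
    IsIntervalFamily R I a b →
    (∀ i → IsInvertibleFuzzyNegation R (Ns i) (Nsinv i)) →
    IsOrdinalSum R I a b Ns NI →
    IsOrdinalSum R I (λ i → 1ℝ - b i) (λ i → 1ℝ - a i) Nsinv NIinv →
    ∀ x → InUnit x → (NI (NIinv x) ≡ x) × (NIinv (NI x) ≡ x)
mainTheorem10 R I a b Ns Nsinv NI NIinv family invertible sum sumInv x x∈I =
    ordinalSum-leftInverse R (λ i → sub-antitone-< R 1ℝ (nonempty i))
      (λ i → proj₁ (proj₂ (inverse i))) (λ i → proj₁ (proj₂ (proj₂ (inverse i))))
      sumInv sum′ x x∈I
  , ordinalSum-leftInverse R nonempty
      (λ i → proj₁ (inverse i)) (λ i → proj₂ (proj₂ (proj₂ (inverse i))))
      sum sumInv x x∈I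
  where
  open RealField R
  open IsIntervalFamily family using (nonempty)
  inverse : ∀ i → IsInverseOnUnit R (Ns i) (Nsinv i)
  inverse i = IsInvertibleFuzzyNegation.isInverse (invertible i)
  sum′ : IsOrdinalSum R I (λ i → 1ℝ - (1ℝ - a i)) (λ i → 1ℝ - (1ℝ - b i)) Ns NI
  sum′ = ordinalSum-cong R (λ i → sym (w-[w-x]≡x R 1ℝ (a i)))
                           (λ i → sym (w-[w-x]≡x R 1ℝ (b i))) sum
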